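{- Let $k,r,t\in\mathbb{N}$ and assume that there exist at least $k$ distinct nonrepetitive $r$-colourings of the $t$-vertex path. Then for every graph $G$ with $\pi(G)\leq k$, $$\pi(G^{(2t+1)}) \leq r+2.$$
   Context: All graphs are finite, simple and undirected. A path in a graph is a sequence of pairwise distinct vertices, consecutive ones adjacent. Given a vertex colouring $\phi$, a sequence $(v_1,\dots,v_{2s})$ is repetitively coloured if $\phi(v_i)=\phi(v_{s+i})$ for all $i\in\{1,\dots,s\}$; a colouring is nonrepetitive if no path is repetitively coloured. An $r$-colouring uses at most $r$ colours. $\pi(G)$ is the minimum number of colours in a nonrepetitive colouring of $G$. For an integer $d\ge 0$, $G^{(d)}$ denotes the $d$-subdivision of $G$: each edge $vw$ is replaced by a path from $v$ to $w$ with exactly $d$ internal vertices, these paths being internally disjoint. -}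

module Defs where

open import Data.Nat using (ℕ; zero; suc; _+_; _≥_; _<ᵇ_)
open import Data.Fin using (Fin; toℕ)
open import Data.Bool using (Bool; true; false; T; _∧_)
open import Data.List using (List; length; map; take; drop)
open import Data.List.Relation.Unary.Linked using (Linked)
open import Data.List.Relation.Unary.Unique.Propositional using (Unique)
open import Data.Product using (Σ; ∃; _×_; _,_; proj₁; proj₂)
open import Data.Sum using (_⊎_; inj₁; inj₂)
open import Relation.Binary.PropositionalEquality using (_≡_; _≢_)
open import Relation.Nullary using (¬_)

record Graph : Set where
  field
    n      : ℕ
    adj    : Fin n → Fin n → Bool
    sym    : ∀ v w → adj v w ≡ adj w v
    irrefl : ∀ v → adj v v ≡ false

-- General (not necessarily finite) vertex set with an adjacency relation;
-- used to talk about paths and colourings uniformly.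

record RelGraph : Set₁ where
  field
    V   : Set
    Adj : V → V → Set

toRel : Graph → RelGraph
toRel G = record { V = Fin (Graph.n G) ; Adj = λ v w → T (Graph.adj G v w) }

module _ (H : RelGraph) where
  open RelGraph H

  IsPath : List V → Set
  IsPath xs = Unique xs × Linked Adj xs

  RepColoured : {C : Set} → (V → C) → List V → Set
  RepColoured φ xs =
    Σ ℕ λ s → s ≥ 1 × length xs ≡ s + s × map φ (take s xs) ≡ map φ (drop s xs)

  Nonrepetitive : (r : ℕ) → (V → Fin r) → Set
  Nonrepetitive r φ = ∀ xs → IsPath xs → ¬ RepColoured φ xs

  -- π(H) ≤ k  (π is the minimum, so this is existence of a nonrepetitive
  -- k-colouring).
  πLeq : ℕ → Set
  πLeq k = Σ (V → Fin k) (Nonrepetitive k)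

PathGraph : ℕ → RelGraph
PathGraph t = record
  { V   = Fin t
  ; Adj = λ i j → (toℕ j ≡ suc (toℕ i)) ⊎ (toℕ i ≡ suc (toℕ j)) }

-- The d-subdivision G^(d).
-- Each edge is represented once, as an ordered pair (v , w) with v < w;
-- it is replaced by the path v, (e,0), (e,1), ..., (e,d-1), w.

module Subdivision (G : Graph) (d : ℕ) where
  open Graph G

  Edge : Set
  Edge = Σ (Fin n × Fin n) λ p → T (adj (proj₁ p) (proj₂ p) ∧ (toℕ (proj₁ p) <ᵇ toℕ (proj₂ p)))

  src tgt : Edge → Fin n
  src e = proj₁ (proj₁ e)
  tgt e = proj₂ (proj₁ e)

  SubV : Set
  SubV = Fin n ⊎ (Edge × Fin d)

  data Arc : SubV → SubV → Set where
    direct : (e : Edge) → d ≡ 0 → Arc (inj₁ (src e)) (inj₁ (tgt e))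
    first  : (e : Edge) (i : Fin d) → toℕ i ≡ 0 → Arc (inj₁ (src e)) (inj₂ (e , i))
    step   : (e : Edge) (i j : Fin d) → toℕ j ≡ suc (toℕ i) →
             Arc (inj₂ (e , i)) (inj₂ (e , j))
    last   : (e : Edge) (i : Fin d) → suc (toℕ i) ≡ d → Arc (inj₂ (e , i)) (inj₁ (tgt e))

  SubAdj : SubV → SubV → Set
  SubAdj x y = Arc x y ⊎ Arc y x

subdivision : Graph → ℕ → RelGraph
subdivision G d = record { V = Subdivision.SubV G d ; Adj = Subdivision.SubAdj G d }

AtLeastKNonrepColourings : (k r t : ℕ) → Set
AtLeastKNonrepColourings k r t =
  Σ (Fin k → Fin t → Fin r) λ c →
    (∀ a → Nonrepetitive (PathGraph t) r (c a)) ×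
    (∀ a b → a ≢ b → ∃ λ x → c a x ≢ c b x)

-- Let ψ be a nonrepetitive k-colouring of G and c₁, …, c_k distinct nonrepetitive colourings
-- of P_t. Colour the branch vertices of G^(2t+1) with a fresh colour A, and the 2t + 1 inner
-- vertices of the path replacing an edge vw (v < w) with c_ψ(v)(0), …, c_ψ(v)(t−1), a second
-- fresh colour B, c_ψ(w)(t−1), …, c_ψ(w)(0).
--
-- A repetitively coloured path avoiding the branch vertices lies inside one subdivided edge:
-- either it stays on one side of the B-vertex, giving a repetition in some c_a, or it contains
-- that vertex, whose colour then has no partner. A path meeting a branch vertex meets them
-- exactly at its A-coloured positions, consecutive ones 2t + 2 apart, so its half-length is
-- h(2t + 2) and its branch vertices form a path on 2h vertices in G. Matching branch vertices
-- v, v′ are followed (or preceded) by t vertices spelling out c_ψ(v) and c_ψ(v′), so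
-- ψ(v) = ψ(v′) as the c_a are distinct, and that path would be repetitive under ψ.

module Submission where

open import Defs

import Algebra.Properties.CommutativeSemigroup as CommSemigroup
open import Data.Bool using (Bool; true; false; T; not)
open import Data.Bool.Properties using (T-∧)
open import Data.Empty using (⊥; ⊥-elim)
open import Data.Fin using (Fin; toℕ; fromℕ<; _↑ˡ_; _↑ʳ_; splitAt) renaming (zero to 0F; suc to sucF)
import Data.Fin.Properties as Fin
open import Data.List using (List; []; _∷_; length; map; take; drop; applyUpTo)
open import Data.List.Properties using (length-applyUpTo; map-applyUpTo)
open import Data.List.Relation.Unary.All using (All; _∷_)
open import Data.List.Relation.Unary.AllPairs using (_∷_)
open import Data.List.Relation.Unary.Linked using (Linked; [-]; _∷_)
import Data.List.Relation.Unary.Linked.Properties as Linked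
open import Data.List.Relation.Unary.Unique.Propositional using (Unique)
import Data.List.Relation.Unary.Unique.Propositional.Properties as Unique
open import Data.Nat
open import Data.Nat.DivMod using (_mod_; _%_; _/_; m<n⇒m%n≡m; m%n<n; m≡m%n+[m/n]*n)
open import Data.Nat.Divisibility using (_∣_; divides; m%n≡0⇒n∣m)
open import Data.Nat.Properties
open import Data.Product using (∃; ∃₂; _×_; _,_; proj₁; proj₂; uncurry)
open import Data.Sum using (_⊎_; inj₁; inj₂; swap; fromInj₁)
open import Data.Sum.Properties using (inj₁-injective)
open import Function using (_∘_)
open import Function.Bundles using (Equivalence)
open import Relation.Nullary using (¬_; Dec; yes; no)
open import Relation.Nullary.Decidable using (decidable-stable)
open import Relation.Binary.PropositionalEquality

open CommSemigroup +-commutativeSemigroup using (x∙yz≈y∙xz; x∙yz≈xz∙y; xy∙z≈xz∙y)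

private variable X Y : Set

lookupℕ : X → List X → ℕ → X
lookupℕ a []       i       = a
lookupℕ a (x ∷ xs) zero    = x
lookupℕ a (x ∷ xs) (suc i) = lookupℕ a xs i

lookupℕ-take : ∀ (a : X) xs {s i} → i < s → lookupℕ a (take s xs) i ≡ lookupℕ a xs i
lookupℕ-take a []       {suc s}          _         = refl
lookupℕ-take a (x ∷ xs) {suc s} {zero}   _         = refl
lookupℕ-take a (x ∷ xs) {suc s} {suc i}  (s≤s i<s) = lookupℕ-take a xs i<s

lookupℕ-drop : ∀ (a : X) xs s i → lookupℕ a (drop s xs) i ≡ lookupℕ a xs (s + i)
lookupℕ-drop a xs       zero    i = refl
lookupℕ-drop a []       (suc s) i = refl
lookupℕ-drop a (x ∷ xs) (suc s) i = lookupℕ-drop a xs s i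

lookupℕ-map : ∀ (f : X → Y) a xs i → lookupℕ (f a) (map f xs) i ≡ f (lookupℕ a xs i)
lookupℕ-map f a []       i       = refl
lookupℕ-map f a (x ∷ xs) zero    = refl
lookupℕ-map f a (x ∷ xs) (suc i) = lookupℕ-map f a xs i

lookupℕ-All : ∀ {P : X → Set} (a : X) {xs} i → All P xs → i < length xs → P (lookupℕ a xs i)
lookupℕ-All a zero    (px ∷ _)   _         = px
lookupℕ-All a (suc i) (_  ∷ pxs) (s≤s i<n) = lookupℕ-All a i pxs i<n

lookupℕ-Linked : ∀ {R : X → X → Set} (a : X) {xs} i → Linked R xs → suc i < length xs →
                 R (lookupℕ a xs i) (lookupℕ a xs (suc i))
lookupℕ-Linked a zero    (r ∷ _)  _         = r
lookupℕ-Linked a (suc i) (_ ∷ rs) (s≤s i<n) = lookupℕ-Linked a i rs i<n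
lookupℕ-Linked a zero    [-]      (s≤s ())
lookupℕ-Linked a (suc i) [-]      (s≤s ())

lookupℕ-injective : ∀ (a : X) {xs} i j → Unique xs → i < length xs → j < length xs →
                    lookupℕ a xs i ≡ lookupℕ a xs j → i ≡ j
lookupℕ-injective a         zero    zero    _          _         _         _  = refl
lookupℕ-injective a {_ ∷ _} zero    (suc j) (x∉ ∷ _)   _         (s≤s j<n) eq =
  ⊥-elim (lookupℕ-All a j x∉ j<n eq)
lookupℕ-injective a {_ ∷ _} (suc i) zero    (x∉ ∷ _)   (s≤s i<n) _         eq =
  ⊥-elim (lookupℕ-All a i x∉ i<n (sym eq))
lookupℕ-injective a {_ ∷ _} (suc i) (suc j) (_ ∷ uniq) (s≤s i<n) (s≤s j<n) eq =
  cong suc (lookupℕ-injective a i j uniq i<n j<n eq)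

take-applyUpTo : ∀ (f : ℕ → X) s m → take s (applyUpTo f (s + m)) ≡ applyUpTo f s
take-applyUpTo f zero    m = refl
take-applyUpTo f (suc s) m = cong (f 0 ∷_) (take-applyUpTo (f ∘ suc) s m)

drop-applyUpTo : ∀ (f : ℕ → X) s m → drop s (applyUpTo f (s + m)) ≡ applyUpTo (f ∘ (s +_)) m
drop-applyUpTo f zero    m = refl
drop-applyUpTo f (suc s) m = drop-applyUpTo (f ∘ suc) s m

applyUpTo-cong : ∀ {f g : ℕ → X} n → (∀ {i} → i < n → f i ≡ g i) →
                 applyUpTo f n ≡ applyUpTo g n
applyUpTo-cong zero    f≗g = refl
applyUpTo-cong (suc n) f≗g = cong₂ _∷_ (f≗g z<s) (applyUpTo-cong n (f≗g ∘ s<s))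

module _ (H : RelGraph) where
  open RelGraph H

  record RepetitivePath {C : Set} (φ : V → C) (s : ℕ) (p : ℕ → V) : Set where
    field
      nonempty  : 1 ≤ s
      adjacent  : ∀ {i} → suc i < s + s → Adj (p i) (p (suc i))
      injective : ∀ {i j} → i < s + s → j < s + s → p i ≡ p j → i ≡ j
      repeats   : ∀ {i} → i < s → φ (p i) ≡ φ (p (s + i))

  repetitivePath : ∀ {C} (φ : V → C) xs → IsPath H xs → RepColoured H φ xs → ∃₂ (RepetitivePath φ)
  repetitivePath φ [] _ (_ , s≤s _ , () , _)
  repetitivePath φ xs@(a ∷ _) (uniq , linked) (s , s≥1 , len , halves) = s , lookupℕ a xs , record
    { nonempty  = s≥1
    ; adjacent  = λ {i} → lookupℕ-Linked a i linked ∘ inRange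
    ; injective = λ {i j} i<2s j<2s → lookupℕ-injective a i j uniq (inRange i<2s) (inRange j<2s)
    ; repeats   = repeats
    }
    where
    inRange : ∀ {i} → i < s + s → i < length xs
    inRange {i} = subst (i <_) (sym len)
    repeats : ∀ {i} → i < s → φ (lookupℕ a xs i) ≡ φ (lookupℕ a xs (s + i))
    repeats {i} i<s = begin
      φ (lookupℕ a xs i)                     ≡⟨ cong φ (lookupℕ-take a xs i<s) ⟨
      φ (lookupℕ a (take s xs) i)            ≡⟨ lookupℕ-map φ a (take s xs) i ⟨
      lookupℕ (φ a) (map φ (take s xs)) i    ≡⟨ cong (λ ys → lookupℕ (φ a) ys i) halves ⟩
      lookupℕ (φ a) (map φ (drop s xs)) i    ≡⟨ lookupℕ-map φ a (drop s xs) i ⟩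
      φ (lookupℕ a (drop s xs) i)            ≡⟨ cong φ (lookupℕ-drop a xs s i) ⟩
      φ (lookupℕ a xs (s + i))               ∎
      where open ≡-Reasoning

  repetitivePath⇒repColoured : ∀ {C} {φ : V → C} {s p} → RepetitivePath φ s p →
                               IsPath H (applyUpTo p (s + s)) × RepColoured H φ (applyUpTo p (s + s))
  repetitivePath⇒repColoured {φ = φ} {s} {p} rp =
    ( Unique.applyUpTo⁺₁ p (s + s) (λ i<j j<n → <⇒≢ i<j ∘ injective (<-trans i<j j<n) j<n)
    , Linked.applyUpTo⁺₁ p (s + s) adjacent )
    , s , nonempty , length-applyUpTo p (s + s) , halves
    where
    open RepetitivePath rp
    open ≡-Reasoning
    halves : map φ (take s (applyUpTo p (s + s))) ≡ map φ (drop s (applyUpTo p (s + s)))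
    halves = begin
      map φ (take s (applyUpTo p (s + s)))  ≡⟨ cong (map φ) (take-applyUpTo p s s) ⟩
      map φ (applyUpTo p s)                 ≡⟨ map-applyUpTo p φ s ⟩
      applyUpTo (φ ∘ p) s                   ≡⟨ applyUpTo-cong s repeats ⟩
      applyUpTo (φ ∘ p ∘ (s +_)) s          ≡⟨ map-applyUpTo (p ∘ (s +_)) φ s ⟨
      map φ (applyUpTo (p ∘ (s +_)) s)      ≡⟨ cong (map φ) (drop-applyUpTo p s s) ⟨
      map φ (drop s (applyUpTo p (s + s)))  ∎

  nonrepetitive⇒¬repetitivePath : ∀ {r φ} → Nonrepetitive H r φ → ∀ {s p} → ¬ RepetitivePath φ s p
  nonrepetitive⇒¬repetitivePath nonrep rp = uncurry (nonrep _) (repetitivePath⇒repColoured rp)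

ℕ-line : RelGraph
ℕ-line = record { V = ℕ ; Adj = λ i j → j ≡ suc i ⊎ i ≡ suc j }

module _ {r t : ℕ} {χ : Fin t → Fin r} (nonrep : Nonrepetitive (PathGraph t) r χ)
         {C : Set} {χ̂ : ℕ → C} (χ̂-reflects : ∀ x y → χ̂ (toℕ x) ≡ χ̂ (toℕ y) → χ x ≡ χ y)
         where

  ¬repetitivePathBelow : ∀ {s g} → RepetitivePath ℕ-line χ̂ s g →
                         (∀ {i} → i < s + s → g i < t) → ⊥
  ¬repetitivePathBelow {s} {g} rp g<t = nonrepetitive⇒¬repetitivePath (PathGraph t) nonrep rp′
    where
    open RepetitivePath rp
    instance
      t≢0 : NonZero t
      t≢0 = >-nonZero (≤-<-trans z≤n (g<t (≤-trans nonempty (m≤m+n s s))))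
    toℕ-mod : ∀ {m} → m < t → toℕ (m mod t) ≡ m
    toℕ-mod m<t = trans (Fin.toℕ-fromℕ< _) (m<n⇒m%n≡m m<t)
    f : ℕ → Fin t
    f i = g i mod t
    toℕ-f : ∀ {i} → i < s + s → toℕ (f i) ≡ g i
    toℕ-f = toℕ-mod ∘ g<t
    adjacent′ : ∀ {i} → suc i < s + s → RelGraph.Adj (PathGraph t) (f i) (f (suc i))
    adjacent′ {i} i+1<2s rewrite toℕ-f i+1<2s | toℕ-f (<-trans (n<1+n i) i+1<2s) = adjacent i+1<2s
    injective′ : ∀ {i j} → i < s + s → j < s + s → f i ≡ f j → i ≡ j
    injective′ i<2s j<2s fi≡fj =
      injective i<2s j<2s (trans (sym (toℕ-f i<2s)) (trans (cong toℕ fi≡fj) (toℕ-f j<2s)))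
    repeats′ : ∀ {i} → i < s → χ (f i) ≡ χ (f (s + i))
    repeats′ {i} i<s = χ̂-reflects (f i) (f (s + i)) (begin
      χ̂ (toℕ (f i))        ≡⟨ cong χ̂ (toℕ-f (≤-trans i<s (m≤m+n s s))) ⟩
      χ̂ (g i)              ≡⟨ repeats i<s ⟩
      χ̂ (g (s + i))        ≡⟨ cong χ̂ (toℕ-f (+-monoʳ-< s i<s)) ⟨
      χ̂ (toℕ (f (s + i)))  ∎)
      where open ≡-Reasoning
    rp′ : RepetitivePath (PathGraph t) χ s f
    rp′ = record
      { nonempty = nonempty ; adjacent = adjacent′ ; injective = injective′ ; repeats = repeats′ }

module Traversal (G : Graph) (d : ℕ) (d≢0 : d ≢ 0) where
  open Graph G renaming (sym to adj-sym)
  open Subdivision G d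

  Branch : SubV → Set
  Branch x = ∃ λ v → x ≡ inj₁ v

  branch? : ∀ x → Dec (Branch x)
  branch? (inj₁ v) = yes (v , refl)
  branch? (inj₂ _) = no λ { (_ , ()) }

  D : ℕ
  D = suc d

  from to : Bool → Edge → Fin n
  from true  = src
  from false = tgt
  to true  = tgt
  to false = src

  from-to-adj : ∀ b e → T (adj (from b e) (to b e))
  from-to-adj true  e = proj₁ (Equivalence.to T-∧ (proj₂ e))
  from-to-adj false e = subst T (adj-sym (src e) (tgt e)) (from-to-adj true e)

  InnerDistance : Bool → Fin d → ℕ → Set
  InnerDistance true  i j = suc (toℕ i) ≡ j
  InnerDistance false i j = toℕ i + j ≡ d

  -- OnEdge e b j x: x is the j-th vertex (0 ≤ j ≤ D) of the path replacing e, traversed from from b e.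
  data OnEdge (e : Edge) (b : Bool) (j : ℕ) : SubV → Set where
    at-from : j ≡ 0 → OnEdge e b j (inj₁ (from b e))
    inner   : (i : Fin d) → InnerDistance b i j → OnEdge e b j (inj₂ (e , i))
    at-to   : j ≡ D → OnEdge e b j (inj₁ (to b e))

  inner-neighbour : ∀ {e i y} → SubAdj (inj₂ (e , i)) y →
     (∃ λ i′ → y ≡ inj₂ (e , i′) × (toℕ i′ ≡ suc (toℕ i) ⊎ suc (toℕ i′) ≡ toℕ i))
     ⊎ (y ≡ inj₁ (tgt e) × suc (toℕ i) ≡ d) ⊎ (y ≡ inj₁ (src e) × toℕ i ≡ 0)
  inner-neighbour (inj₁ (step _ _ j eq)) = inj₁ (j , refl , inj₁ eq)
  inner-neighbour (inj₁ (last _ _ eq))   = inj₂ (inj₁ (refl , eq))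
  inner-neighbour (inj₂ (first _ _ eq))  = inj₂ (inj₂ (refl , eq))
  inner-neighbour (inj₂ (step _ i _ eq)) = inj₁ (i , refl , inj₂ (sym eq))

  branch-neighbour : ∀ {v y} → SubAdj (inj₁ v) y → ∃₂ λ e b → from b e ≡ v × OnEdge e b 1 y
  branch-neighbour (inj₁ (direct e d≡0))  = ⊥-elim (d≢0 d≡0)
  branch-neighbour (inj₂ (direct e d≡0))  = ⊥-elim (d≢0 d≡0)
  branch-neighbour (inj₁ (first e i i≡0)) = e , true , refl , inner i (cong suc i≡0)
  branch-neighbour (inj₂ (last e i i+1≡d)) = e , false , refl , inner i (trans (+-comm (toℕ i) 1) i+1≡d)

  innerDistance-bounds : ∀ b (i : Fin d) {j} → InnerDistance b i j → 1 ≤ j × j ≤ d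
  innerDistance-bounds true  i refl = s≤s z≤n , Fin.toℕ<n i
  innerDistance-bounds false i {zero}  i+0≡d =
    ⊥-elim (<⇒≢ (Fin.toℕ<n i) (trans (sym (+-identityʳ _)) i+0≡d))
  innerDistance-bounds false i {suc j} i+j≡d =
    s≤s z≤n , subst (suc j ≤_) i+j≡d (m≤n+m (suc j) (toℕ i))

  innerDistance-injective : ∀ b {i i′ : Fin d} {j} →
                            InnerDistance b i j → InnerDistance b i′ j → i ≡ i′
  innerDistance-injective true  refl  i′+1≡i+1 = Fin.toℕ-injective (suc-injective (sym i′+1≡i+1))
  innerDistance-injective false i+j≡d i′+j≡d  =
    Fin.toℕ-injective (+-cancelʳ-≡ _ _ _ (trans i+j≡d (sym i′+j≡d)))

  onEdge-bounds : ∀ {e b j x} → OnEdge e b j x → ¬ Branch x → 1 ≤ j × j ≤ d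
  onEdge-bounds (at-from _) ¬branch = ⊥-elim (¬branch (_ , refl))
  onEdge-bounds (at-to _)   ¬branch = ⊥-elim (¬branch (_ , refl))
  onEdge-bounds {b = b} (inner i dist) _ = innerDistance-bounds b i dist

  onEdge-¬branch : ∀ {e b j x} → 1 ≤ j → j ≤ d → OnEdge e b j x → ¬ Branch x
  onEdge-¬branch (s≤s _) _   (at-from ())
  onEdge-¬branch _       _   (inner _ _) (_ , ())
  onEdge-¬branch _       j≤d (at-to refl) _ = 1+n≰n j≤d

  onEdge-to : ∀ {e b x} → OnEdge e b D x → x ≡ inj₁ (to b e)
  onEdge-to (at-from ())
  onEdge-to {b = b} (inner i dist) = ⊥-elim (1+n≰n (proj₂ (innerDistance-bounds b i dist)))
  onEdge-to (at-to _) = refl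

  onEdge-unique : ∀ {e b j x y} → OnEdge e b j x → OnEdge e b j y → x ≡ y
  onEdge-unique (at-from _)    (at-from _)    = refl
  onEdge-unique (at-to _)      (at-to _)      = refl
  onEdge-unique (at-from refl) (at-to ())
  onEdge-unique (at-to refl)   (at-from ())
  onEdge-unique {e} {b} (inner i dist) (inner i′ dist′) =
    cong (λ k → inj₂ (e , k)) (innerDistance-injective b dist dist′)
  onEdge-unique {b = b} (at-from refl) (inner i dist) = ⊥-elim (1+n≰n (proj₁ (innerDistance-bounds b i dist)))
  onEdge-unique {b = b} (inner i dist) (at-from refl) = ⊥-elim (1+n≰n (proj₁ (innerDistance-bounds b i dist)))
  onEdge-unique {b = b} (at-to refl)   (inner i dist) = ⊥-elim (1+n≰n (proj₂ (innerDistance-bounds b i dist)))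
  onEdge-unique {b = b} (inner i dist) (at-to refl)   = ⊥-elim (1+n≰n (proj₂ (innerDistance-bounds b i dist)))

  onEdge-neighbours : ∀ {e b j y z} → OnEdge e b (suc j) y → suc j ≤ d → SubAdj y z →
                      OnEdge e b j z ⊎ OnEdge e b (2 + j) z
  onEdge-neighbours (at-from ())
  onEdge-neighbours (at-to j+1≡d+1) j+1≤d _ = ⊥-elim (1+n≰n (subst (_≤ d) j+1≡d+1 j+1≤d))
  onEdge-neighbours {b = true} (inner i i+1≡j+1) _ y~z with inner-neighbour y~z
  ... | inj₁ (i′ , refl , inj₁ i′≡i+1)  = inj₂ (inner i′ (cong suc (trans i′≡i+1 i+1≡j+1)))
  ... | inj₁ (i′ , refl , inj₂ i′+1≡i)  = inj₁ (inner i′ (trans i′+1≡i (suc-injective i+1≡j+1)))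
  ... | inj₂ (inj₁ (refl , i+1≡d))     = inj₂ (at-to (cong suc (trans (sym i+1≡j+1) i+1≡d)))
  ... | inj₂ (inj₂ (refl , i≡0))       = inj₁ (at-from (trans (sym (suc-injective i+1≡j+1)) i≡0))
  onEdge-neighbours {b = false} {j} (inner i i+j+1≡d) _ y~z with inner-neighbour y~z
  ... | inj₁ (i′ , refl , inj₁ i′≡i+1) =
    inj₁ (inner i′ (trans (cong (_+ j) i′≡i+1) (trans (sym (+-suc (toℕ i) j)) i+j+1≡d)))
  ... | inj₁ (i′ , refl , inj₂ i′+1≡i) =
    inj₂ (inner i′ (trans (+-suc (toℕ i′) (suc j)) (trans (cong (_+ suc j) i′+1≡i) i+j+1≡d)))
  ... | inj₂ (inj₁ (refl , i+1≡d)) =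
    inj₁ (at-from (suc-injective (+-cancelˡ-≡ (toℕ i) _ _ (trans i+j+1≡d (trans (sym i+1≡d) (+-comm 1 (toℕ i)))))))
  ... | inj₂ (inj₂ (refl , i≡0)) =
    inj₂ (at-to (cong suc (subst (λ k → k + suc j ≡ d) i≡0 i+j+1≡d)))

  onEdge-step : ∀ {e b j x y z} → OnEdge e b j x → OnEdge e b (suc j) y → suc j ≤ d →
                SubAdj y z → z ≢ x → OnEdge e b (2 + j) z
  onEdge-step onx ony j+1≤d y~z z≢x with onEdge-neighbours ony j+1≤d y~z
  ... | inj₁ onz = ⊥-elim (z≢x (onEdge-unique onz onx))
  ... | inj₂ onz = onz

  onEdge-flip : ∀ {e b j j′ x} → OnEdge e b j x → j + j′ ≡ D → OnEdge e (not b) j′ x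
  onEdge-flip {b = true}  (at-from refl) j′≡D = at-to j′≡D
  onEdge-flip {b = false} (at-from refl) j′≡D = at-to j′≡D
  onEdge-flip {b = true}  (at-to refl) D+j′≡D = at-from (+-cancelˡ-≡ D _ 0 (trans D+j′≡D (sym (+-identityʳ D))))
  onEdge-flip {b = false} (at-to refl) D+j′≡D = at-from (+-cancelˡ-≡ D _ 0 (trans D+j′≡D (sym (+-identityʳ D))))
  onEdge-flip {b = true}  (inner i refl) i+1+j′≡D = inner i (suc-injective i+1+j′≡D)
  onEdge-flip {b = false} {j = j} {j′} (inner i i+j≡d) j+j′≡D = inner i (+-cancelʳ-≡ d _ _ (begin
      suc (toℕ i) + d   ≡⟨ +-suc (toℕ i) d ⟨
      toℕ i + D         ≡⟨ cong (toℕ i +_) j+j′≡D ⟨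
      toℕ i + (j + j′)  ≡⟨ +-assoc (toℕ i) j j′ ⟨
      toℕ i + j + j′    ≡⟨ cong (_+ j′) i+j≡d ⟩
      d + j′            ≡⟨ +-comm d j′ ⟩
      j′ + d            ∎))
    where open ≡-Reasoning

  record NonBacktrackingWalk (L : ℕ) (f : ℕ → SubV) : Set where
    field
      adjacent        : ∀ {i} → suc i ≤ L → SubAdj (f i) (f (suc i))
      nonbacktracking : ∀ {i} → 2 + i ≤ L → f (2 + i) ≢ f i

  module _ {L f} (walk : NonBacktrackingWalk L f) where
    open NonBacktrackingWalk walk

    walk-followsEdge : ∀ {e b j₀} → OnEdge e b j₀ (f 0) → (1 ≤ L → OnEdge e b (suc j₀) (f 1)) →
      (∀ {i} → 2 + i ≤ L → OnEdge e b (suc i + j₀) (f (suc i)) → suc i + j₀ ≤ d) →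
      ∀ {i} → i ≤ L → OnEdge e b (i + j₀) (f i)
    walk-followsEdge {e} {b} {j₀} on₀ on₁ inside {zero}  _     = on₀
    walk-followsEdge {e} {b} {j₀} on₀ on₁ inside {suc i} i+1≤L = proj₂ (consecutive i i+1≤L)
      where
      consecutive : ∀ i → suc i ≤ L → OnEdge e b (i + j₀) (f i) × OnEdge e b (suc i + j₀) (f (suc i))
      consecutive zero    1≤L   = on₀ , on₁ 1≤L
      consecutive (suc i) i+2≤L with consecutive i (≤-trans (n≤1+n _) i+2≤L)
      ... | onᵢ , onᵢ₊₁ =
        onᵢ₊₁ , onEdge-step onᵢ onᵢ₊₁ (inside i+2≤L onᵢ₊₁) (adjacent i+2≤L) (nonbacktracking i+2≤L)

    walk-fromBranch : ∀ {v} → L ≤ D → 1 ≤ L → f 0 ≡ inj₁ v →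
      ∃₂ λ e b → from b e ≡ v × (∀ {j} → j ≤ L → OnEdge e b j (f j))
    walk-fromBranch {v} L≤D 1≤L f0≡v
      with branch-neighbour (subst (λ x → SubAdj x (f 1)) f0≡v (adjacent 1≤L))
    ... | e , b , refl , on₁ = e , b , refl , λ {j} j≤L →
      subst (λ k → OnEdge e b k (f j)) (+-identityʳ j) (walk-followsEdge on₀ (λ _ → on₁) inside j≤L)
      where
      on₀ : OnEdge e b 0 (f 0)
      on₀ = subst (OnEdge e b 0) (sym f0≡v) (at-from refl)
      inside : ∀ {i} → 2 + i ≤ L → OnEdge e b (suc i + 0) (f (suc i)) → suc i + 0 ≤ d
      inside {i} i+2≤L _ = subst (_≤ d) (sym (+-identityʳ (suc i))) (s≤s⁻¹ (≤-trans i+2≤L L≤D))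

  inner-adjacent-onEdge : ∀ {x y} → SubAdj x y → ¬ Branch x → ¬ Branch y →
     ∃₂ λ e b → ∃ λ j₀ → OnEdge e b j₀ x × OnEdge e b (suc j₀) y
  inner-adjacent-onEdge {inj₁ v} _ ¬branch _ = ⊥-elim (¬branch (v , refl))
  inner-adjacent-onEdge {inj₂ (e , i)} x~y _ ¬branch with inner-neighbour x~y
  ... | inj₁ (i′ , refl , inj₁ i′≡i+1) = e , true , suc (toℕ i) , inner i refl , inner i′ (cong suc i′≡i+1)
  ... | inj₁ (i′ , refl , inj₂ i′+1≡i) =
    e , false , j₀ , inner i i+j₀≡d , inner i′ (trans (+-suc (toℕ i′) j₀) (trans (cong (_+ j₀) i′+1≡i) i+j₀≡d))
    where
    j₀ = d ∸ toℕ i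
    i+j₀≡d = m+[n∸m]≡n (<⇒≤ (Fin.toℕ<n i))
  ... | inj₂ (inj₁ (refl , _)) = ⊥-elim (¬branch (_ , refl))
  ... | inj₂ (inj₂ (refl , _)) = ⊥-elim (¬branch (_ , refl))

  walk-avoidingBranches : ∀ {L f} → NonBacktrackingWalk L f →
     (∀ {i} → i ≤ L → ¬ Branch (f i)) → 1 ≤ L →
     ∃₂ λ e b → ∃ λ j₀ → ∀ {i} → i ≤ L → OnEdge e b (i + j₀) (f i)
  walk-avoidingBranches {L} {f} walk ¬branch 1≤L
    with inner-adjacent-onEdge (NonBacktrackingWalk.adjacent walk 1≤L) (¬branch z≤n) (¬branch 1≤L)
  ... | e , b , j₀ , on₀ , on₁ = e , b , j₀ , walk-followsEdge walk on₀ (λ _ → on₁)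
          (λ i+2≤L on → proj₂ (onEdge-bounds on (¬branch (≤-trans (n≤1+n _) i+2≤L))))

  module OnPath (N : ℕ) (p : ℕ → SubV)
                (adjacent : ∀ {i} → suc i < N → SubAdj (p i) (p (suc i)))
                (injective : ∀ {i j} → i < N → j < N → p i ≡ p j → i ≡ j) where

    forwardWalk : ∀ a L → a + L < N → NonBacktrackingWalk L (λ i → p (a + i))
    forwardWalk a L a+L<N = record
      { adjacent        = λ {i} i+1≤L → subst (λ k → SubAdj (p (a + i)) (p k)) (sym (+-suc a i))
                            (adjacent (subst (_< N) (+-suc a i) (inRange i+1≤L)))
      ; nonbacktracking = λ {i} i+2≤L p≡p → m≢1+n+m i {1} (sym (+-cancelˡ-≡ a _ _
                            (injective (inRange i+2≤L) (inRange (≤-trans (m≤n+m i 2) i+2≤L)) p≡p)))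
      }
      where
      inRange : ∀ {i} → i ≤ L → a + i < N
      inRange i≤L = ≤-<-trans (+-monoʳ-≤ a i≤L) a+L<N

    backwardWalk : ∀ a L → L ≤ a → a < N → NonBacktrackingWalk L (λ i → p (a ∸ i))
    backwardWalk a L L≤a a<N = record
      { adjacent        = λ {i} i+1≤L → subst (λ k → SubAdj (p k) (p (a ∸ suc i)))
                            (sym (a∸i≡1+a∸[1+i] i+1≤L))
                            (swap (adjacent (subst (_< N) (a∸i≡1+a∸[1+i] i+1≤L) (inRange i))))
      ; nonbacktracking = λ {i} i+2≤L p≡p → m≢1+n+m i {1} (sym (∸-cancelˡ-≡
                            (≤-trans i+2≤L L≤a) (≤-trans (m≤n+m i 2) (≤-trans i+2≤L L≤a))
                            (injective (inRange (2 + i)) (inRange i) p≡p)))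
      }
      where
      inRange : ∀ i → a ∸ i < N
      inRange i = ≤-<-trans (m∸n≤m a i) a<N
      a∸i≡1+a∸[1+i] : ∀ {i} → suc i ≤ L → a ∸ i ≡ suc (a ∸ suc i)
      a∸i≡1+a∸[1+i] i+1≤L = +-∸-assoc 1 (≤-trans i+1≤L L≤a)

    edgeAfter : ∀ a L {v} → p a ≡ inj₁ v → L ≤ D → 1 ≤ L → a + L < N →
                ∃₂ λ e b → from b e ≡ v × (∀ {j} → j ≤ L → OnEdge e b j (p (a + j)))
    edgeAfter a L pa≡v L≤D 1≤L a+L<N =
      walk-fromBranch (forwardWalk a L a+L<N) L≤D 1≤L (trans (cong p (+-identityʳ a)) pa≡v)

    edgeBefore : ∀ a L {v} → p a ≡ inj₁ v → L ≤ D → 1 ≤ L → L ≤ a → a < N →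
                 ∃₂ λ e b → from b e ≡ v × (∀ {j} → j ≤ L → OnEdge e b j (p (a ∸ j)))
    edgeBefore a L pa≡v L≤D 1≤L L≤a a<N = walk-fromBranch (backwardWalk a L L≤a a<N) L≤D 1≤L pa≡v

    nextBranch : ∀ a {v} → p a ≡ inj₁ v → a + D < N →
                 ∃ λ w → p (a + D) ≡ inj₁ w × T (adj v w)
    nextBranch a pa≡v a+D<N with edgeAfter a D pa≡v ≤-refl (s≤s z≤n) a+D<N
    ... | e , b , refl , on = to b e , onEdge-to (on ≤-refl) , from-to-adj b e

    previousBranch : ∀ a → Branch (p a) → D ≤ a → a < N → Branch (p (a ∸ D))
    previousBranch a (v , pa≡v) D≤a a<N with edgeBefore a D pa≡v ≤-refl (s≤s z≤n) D≤a a<N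
    ... | e , b , _ , on = to b e , onEdge-to (on ≤-refl)

    ¬branch-inside : ∀ a j → Branch (p a) → 1 ≤ j → j ≤ d → a + j < N → ¬ Branch (p (a + j))
    ¬branch-inside a j (v , pa≡v) 1≤j j≤d a+j<N
      with edgeAfter a j pa≡v (≤-trans j≤d (n≤1+n d)) 1≤j a+j<N
    ... | e , b , _ , on = onEdge-¬branch 1≤j j≤d (on ≤-refl)

    branch-forward : ∀ j {a} → Branch (p a) → a + j * D < N → Branch (p (a + j * D))
    branch-forward zero    {a} br _ = subst (Branch ∘ p) (sym (+-identityʳ a)) br
    branch-forward (suc j) {a} (v , pa≡v) a+[j+1]D<N =
      subst (Branch ∘ p) (+-assoc a D (j * D)) (branch-forward j next bound)
      where
      bound : a + D + j * D < N
      bound = subst (_< N) (sym (+-assoc a D (j * D))) a+[j+1]D<N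
      next : Branch (p (a + D))
      next = let w , pa+D≡w , _ = nextBranch a pa≡v (≤-<-trans (m≤m+n (a + D) (j * D)) bound)
             in w , pa+D≡w

    branch-backward : ∀ j {a} → Branch (p (a + j * D)) → a + j * D < N → Branch (p a)
    branch-backward zero    {a} br _ = subst (Branch ∘ p) (+-identityʳ a) br
    branch-backward (suc j) {a} br a+[j+1]D<N =
      subst (Branch ∘ p) (m+n∸n≡m a D)
        (previousBranch (a + D) br′ (m≤n+m D a) (≤-<-trans (m≤m+n (a + D) (j * D)) bound))
      where
      bound : a + D + j * D < N
      bound = subst (_< N) (sym (+-assoc a D (j * D))) a+[j+1]D<N
      br′ : Branch (p (a + D))
      br′ = branch-backward j (subst (Branch ∘ p) (sym (+-assoc a D (j * D))) br) bound

    branch-gap : ∀ {a} m → Branch (p a) → Branch (p (a + m)) → a + m < N → D ∣ m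
    branch-gap {a} m br br′ a+m<N with m % D in m%D≡r
    ... | zero  = m%n≡0⇒n∣m m D m%D≡r
    ... | suc r = ⊥-elim (¬branch-inside a′ (suc r) (branch-forward (m / D) br a′<N) (s≤s z≤n) r<d
                            a′+r<N (subst (Branch ∘ p) a+m≡a′+r br′))
      where
      a′ = a + m / D * D
      a+m≡a′+r : a + m ≡ a′ + suc r
      a+m≡a′+r = begin
        a + m                    ≡⟨ cong (a +_) (m≡m%n+[m/n]*n m D) ⟩
        a + (m % D + m / D * D)  ≡⟨ cong (λ k → a + (k + m / D * D)) m%D≡r ⟩
        a + (suc r + m / D * D)  ≡⟨ x∙yz≈xz∙y a (suc r) (m / D * D) ⟩
        a′ + suc r               ∎
        where open ≡-Reasoning
      a′+r<N : a′ + suc r < N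
      a′+r<N = subst (_< N) a+m≡a′+r a+m<N
      a′<N : a′ < N
      a′<N = ≤-<-trans (m≤m+n a′ (suc r)) a′+r<N
      r<d : suc r ≤ d
      r<d = s≤s⁻¹ (subst (_< D) m%D≡r (m%n<n m D))

module Colouring {k r t : ℕ} (c : Fin k → Fin t → Fin r) (G : Graph) (ψ : Fin (Graph.n G) → Fin k) where
  d : ℕ
  d = 2 * t + 1

  open Subdivision G d

  d≡1+2t : d ≡ suc (t + t)
  d≡1+2t = trans (+-comm (2 * t) 1) (cong (λ m → suc (t + m)) (+-identityʳ t))

  open Traversal G d (λ d≡0 → 0≢1+n (trans (sym d≡0) d≡1+2t)) public

  2t<d : t + t < d
  2t<d = ≤-reflexive (sym d≡1+2t)

  t≤D : t ≤ D
  t≤D = ≤-trans (m≤m+n t t) (<⇒≤ (<-trans 2t<d (n<1+n d)))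

  A B : Fin (r + 2)
  A = r ↑ʳ 0F
  B = r ↑ʳ sucF 0F

  A≢B : A ≢ B
  A≢B A≡B with Fin.↑ʳ-injective r 0F (sucF 0F) A≡B
  ... | ()

  ↑ˡ≢↑ʳ : ∀ (x : Fin r) y → x ↑ˡ 2 ≢ r ↑ʳ y
  ↑ˡ≢↑ʳ x y eq
    with trans (sym (Fin.splitAt-↑ˡ r x 2)) (trans (cong (splitAt r) eq) (Fin.splitAt-↑ʳ r 2 y))
  ... | ()

  col : Fin k → ℕ → Fin (r + 2)
  col a m with m <? t
  ... | yes m<t = c a (fromℕ< m<t) ↑ˡ 2
  ... | no  _   = B

  col-toℕ : ∀ a x → col a (toℕ x) ≡ c a x ↑ˡ 2
  col-toℕ a x with toℕ x <? t
  ... | yes x<t = cong (λ y → c a y ↑ˡ 2) (Fin.fromℕ<-toℕ x x<t)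
  ... | no  x≮t = ⊥-elim (x≮t (Fin.toℕ<n x))

  col-reflects : ∀ a a′ x y → col a (toℕ x) ≡ col a′ (toℕ y) → c a x ≡ c a′ y
  col-reflects a a′ x y eq =
    Fin.↑ˡ-injective 2 _ _ (trans (sym (col-toℕ a x)) (trans eq (col-toℕ a′ y)))

  col≢A : ∀ a m → col a m ≢ A
  col≢A a m with m <? t
  ... | yes _ = ↑ˡ≢↑ʳ _ _
  ... | no  _ = A≢B ∘ sym

  col≢B : ∀ a {m} → m < t → col a m ≢ B
  col≢B a {m} m<t with m <? t
  ... | yes _   = ↑ˡ≢↑ʳ _ _
  ... | no  m≮t = ⊥-elim (m≮t m<t)

  col≡B : ∀ a {m} → t ≤ m → col a m ≡ B
  col≡B a {m} t≤m with m <? t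
  ... | yes m<t = ⊥-elim (<⇒≱ m<t t≤m)
  ... | no  _   = refl

  innerColour : Edge → (m : ℕ) → Dec (m < t) → Fin (r + 2)
  innerColour e m (yes _) = col (ψ (src e)) m
  innerColour e m (no  _) = col (ψ (tgt e)) (t + t ∸ m)

  φ : SubV → Fin (r + 2)
  φ (inj₁ _)       = A
  φ (inj₂ (e , i)) = innerColour e (toℕ i) (toℕ i <? t)

  innerColour-< : ∀ e {m} m<t? → m < t → innerColour e m m<t? ≡ col (ψ (src e)) m
  innerColour-< e (yes _)   _   = refl
  innerColour-< e (no  m≮t) m<t = ⊥-elim (m≮t m<t)

  innerColour-≥ : ∀ e {m} m<t? → t ≤ m → innerColour e m m<t? ≡ col (ψ (tgt e)) (t + t ∸ m)
  innerColour-≥ e (yes m<t) t≤m = ⊥-elim (<⇒≱ m<t t≤m)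
  innerColour-≥ e (no  _)   _   = refl

  φ-inner-< : ∀ e i → toℕ i < t → φ (inj₂ (e , i)) ≡ col (ψ (src e)) (toℕ i)
  φ-inner-< e i = innerColour-< e (toℕ i <? t)

  φ-inner-≥ : ∀ e i → t ≤ toℕ i → φ (inj₂ (e , i)) ≡ col (ψ (tgt e)) (t + t ∸ toℕ i)
  φ-inner-≥ e i = innerColour-≥ e (toℕ i <? t)

  innerColour≢A : ∀ e {m} m<t? → innerColour e m m<t? ≢ A
  innerColour≢A e (yes _) = col≢A _ _
  innerColour≢A e (no  _) = col≢A _ _

  innerColour≡B : ∀ e {m} m<t? → m ≤ t + t → innerColour e m m<t? ≡ B → m ≡ t
  innerColour≡B e (yes m<t) _ col≡B′ = ⊥-elim (col≢B _ m<t col≡B′)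
  innerColour≡B e {m} (no m≮t) m≤2t col≡B′ = ≤-antisym m≤t (≮⇒≥ m≮t)
    where
    t≤2t∸m : t ≤ t + t ∸ m
    t≤2t∸m = ≮⇒≥ (λ 2t∸m<t → col≢B _ 2t∸m<t col≡B′)
    m≤t : m ≤ t
    m≤t = +-cancelʳ-≤ t m t (subst (m + t ≤_) (m+[n∸m]≡n m≤2t) (+-monoʳ-≤ m t≤2t∸m))

  φ-branch : ∀ {x} → Branch x → φ x ≡ A
  φ-branch (_ , refl) = refl

  φ≡A⇒branch : ∀ x → φ x ≡ A → Branch x
  φ≡A⇒branch (inj₁ v)       _    = v , refl
  φ≡A⇒branch (inj₂ (e , i)) φ≡A = ⊥-elim (innerColour≢A e (toℕ i <? t) φ≡A)

  φ-inner≡B : ∀ e i → φ (inj₂ (e , i)) ≡ B → toℕ i ≡ t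
  φ-inner≡B e i = innerColour≡B e (toℕ i <? t) (s≤s⁻¹ (subst (toℕ i <_) d≡1+2t (Fin.toℕ<n i)))

  φ-inner-t : ∀ e i → toℕ i ≡ t → φ (inj₂ (e , i)) ≡ B
  φ-inner-t e i i≡t =
    trans (φ-inner-≥ e i (≤-reflexive (sym i≡t)))
          (col≡B _ (≤-reflexive (sym (trans (cong (t + t ∸_) i≡t) (m+n∸n≡m t t)))))

  onEdge-colour : ∀ {e b m x} → OnEdge e b (suc m) x → m < t → φ x ≡ col (ψ (from b e)) m
  onEdge-colour (at-from ())
  onEdge-colour (at-to m+1≡d+1) m<t =
    ⊥-elim (<⇒≢ (<-trans (<-≤-trans m<t (m≤m+n t t)) 2t<d) (suc-injective m+1≡d+1))
  onEdge-colour {e} {true} (inner i refl) i<t = φ-inner-< e i i<t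
  onEdge-colour {e} {false} {m} (inner i i+m+1≡d) m<t =
    trans (φ-inner-≥ e i t≤i)
          (cong (col _) (trans (cong (_∸ toℕ i) (sym i+m≡2t)) (m+n∸m≡n (toℕ i) m)))
    where
    i+m≡2t : toℕ i + m ≡ t + t
    i+m≡2t = suc-injective (trans (sym (+-suc (toℕ i) m)) (trans i+m+1≡d d≡1+2t))
    t≤i : t ≤ toℕ i
    t≤i = ≮⇒≥ (λ i<t → <⇒≢ (+-mono-< i<t m<t) i+m≡2t)

  onEdge-middle : ∀ {e b x} → OnEdge e b (suc t) x → φ x ≡ B
  onEdge-middle (at-from ())
  onEdge-middle (at-to t+1≡d+1) = ⊥-elim (m≢1+m+n t (trans (suc-injective t+1≡d+1) d≡1+2t))
  onEdge-middle {e} {true}  (inner i i+1≡t+1) = φ-inner-t e i (suc-injective i+1≡t+1)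
  onEdge-middle {e} {false} (inner i i+t+1≡d) =
    φ-inner-t e i (+-cancelʳ-≡ (suc t) _ _ (trans i+t+1≡d (trans d≡1+2t (sym (+-suc t t)))))

  φ≡B⇒middle : ∀ {e b j x} → OnEdge e b j x → φ x ≡ B → j ≡ suc t
  φ≡B⇒middle (at-from _) A≡B = ⊥-elim (A≢B A≡B)
  φ≡B⇒middle (at-to _)   A≡B = ⊥-elim (A≢B A≡B)
  φ≡B⇒middle {e} {true}  (inner i refl) φ≡B = cong suc (φ-inner≡B e i φ≡B)
  φ≡B⇒middle {e} {false} {j} (inner i i+j≡d) φ≡B =
    +-cancelˡ-≡ t _ _
      (trans (subst (λ k → k + j ≡ d) (φ-inner≡B e i φ≡B) i+j≡d) (trans d≡1+2t (sym (+-suc t t))))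

module Repetitions {k r t : ℕ} {c : Fin k → Fin t → Fin r}
    (c-nonrep : ∀ a → Nonrepetitive (PathGraph t) r (c a))
    (c-distinct : ∀ a b → a ≢ b → ∃ λ x → c a x ≢ c b x)
    (G : Graph) {ψ : Fin (Graph.n G) → Fin k} (ψ-nonrep : Nonrepetitive (toRel G) k ψ) where
  open Graph G using (n; adj)
  open Colouring c G ψ
  open Subdivision G d

  module _ {s p} (rp : RepetitivePath (subdivision G d) φ s p) where
    open RepetitivePath rp
    open OnPath (s + s) p adjacent injective

    L : ℕ
    L = pred (s + s)

    first-half : ∀ {i} → i < s → i < s + s
    first-half i<s = <-≤-trans i<s (m≤m+n s s)

    second-half : ∀ {i} → i < s → s + i < s + s
    second-half = +-monoʳ-< s

    instance
      2s≢0 : NonZero (s + s)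
      2s≢0 = >-nonZero (first-half nonempty)

    s+i≢i : ∀ {i} → s + i ≢ i
    s+i≢i {i} s+i≡i = <⇒≢ (m<n+m i nonempty) (sym s+i≡i)

    half-index : ∀ {m} → m < s + s → ∃ λ i → i < s × (m ≡ i ⊎ m ≡ s + i)
    half-index {m} m<2s with m <? s
    ... | yes m<s = m , m<s , inj₁ refl
    ... | no  m≮s with m≤n⇒∃[o]m+o≡n (≮⇒≥ m≮s)
    ...   | i , s+i≡m = i , +-cancelˡ-< s i s (subst (_< s + s) (sym s+i≡m) m<2s) , inj₂ (sym s+i≡m)

    both-halves : ∀ {P : Fin (r + 2) → Set} {m} → m < s + s → P (φ (p m)) →
                  ∃ λ i → i < s × P (φ (p i)) × P (φ (p (s + i)))
    both-halves {P} m<2s Pm with half-index m<2s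
    ... | i , i<s , inj₁ refl = i , i<s , Pm , subst P (repeats i<s) Pm
    ... | i , i<s , inj₂ refl = i , i<s , subst P (sym (repeats i<s)) Pm , Pm

    ¬runOnEdge : ∀ {e b} g → (∀ {i} → i < s + s → OnEdge e b (suc (g i)) (p i)) →
                 (∀ {i} → i < s + s → g i < t) →
                 (∀ {i} → suc i < s + s → RelGraph.Adj ℕ-line (g i) (g (suc i))) →
                 (∀ {i j} → i < s + s → j < s + s → g i ≡ g j → i ≡ j) → ⊥
    ¬runOnEdge {e} {b} g on g<t g-adjacent g-injective =
      ¬repetitivePathBelow (c-nonrep a) (col-reflects a a) run g<t
      where
      a = ψ (from b e)
      colour : ∀ {i} → i < s + s → φ (p i) ≡ col a (g i)
      colour i<2s = onEdge-colour (on i<2s) (g<t i<2s)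
      run : RepetitivePath ℕ-line (col a) s g
      run = record
        { nonempty  = nonempty
        ; adjacent  = g-adjacent
        ; injective = g-injective
        ; repeats   = λ i<s →
            trans (sym (colour (first-half i<s))) (trans (repeats i<s) (colour (second-half i<s)))
        }

    module InsideEdge {e b j₀} (on : ∀ {i} → i < s + s → OnEdge e b (i + j₀) (p i))
                      (¬branch : ∀ {i} → i < s + s → ¬ Branch (p i)) where
      bounds : ∀ {i} → i < s + s → 1 ≤ i + j₀ × i + j₀ ≤ d
      bounds i<2s = onEdge-bounds (on i<2s) (¬branch i<2s)

      ¬firstHalf : L + j₀ ≤ t → ⊥
      ¬firstHalf L+j₀≤t = ¬runOnEdge (_+ pred j₀)
        (λ {i} i<2s → subst (λ k → OnEdge e b k (p i)) (shift i) (on i<2s))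
        (λ {i} i<2s →
          ≤-trans (subst (_≤ L + j₀) (shift i) (+-monoˡ-≤ j₀ (<⇒≤pred i<2s))) L+j₀≤t)
        (λ _ → inj₁ refl)
        (λ {i} {j} _ _ → +-cancelʳ-≡ (pred j₀) i j)
        where
        instance
          j₀≢0 : NonZero j₀
          j₀≢0 = >-nonZero (proj₁ (bounds (first-half nonempty)))
        shift : ∀ i → i + j₀ ≡ suc (i + pred j₀)
        shift i = trans (cong (i +_) (sym (suc-pred j₀))) (+-suc i (pred j₀))

      ¬secondHalf : 2 + t ≤ j₀ → ⊥
      ¬secondHalf t+2≤j₀ = ¬runOnEdge g
        (λ {i} i<2s → onEdge-flip (on i<2s) (trans (+-suc (i + j₀) (g i)) (cong suc (i+j₀+gi≡d i<2s))))
        g<t g-adjacent g-injective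
        where
        g : ℕ → ℕ
        g i = d ∸ (i + j₀)
        i+j₀+gi≡d : ∀ {i} → i < s + s → i + j₀ + g i ≡ d
        i+j₀+gi≡d i<2s = m+[n∸m]≡n (proj₂ (bounds i<2s))
        g<t : ∀ {i} → i < s + s → g i < t
        g<t {i} i<2s = +-cancelˡ-≤ t (suc (g i)) t (subst (_≤ t + t) (sym (+-suc t (g i))) (s≤s⁻¹ (begin
          suc (suc t) + g i  ≤⟨ +-monoˡ-≤ (g i) (≤-trans t+2≤j₀ (m≤n+m j₀ i)) ⟩
          i + j₀ + g i       ≡⟨ trans (i+j₀+gi≡d i<2s) d≡1+2t ⟩
          suc (t + t)        ∎)))
          where open ≤-Reasoning
        g-adjacent : ∀ {i} → suc i < s + s → RelGraph.Adj ℕ-line (g i) (g (suc i))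
        g-adjacent {i} i+1<2s = inj₂ (+-cancelˡ-≡ (i + j₀) _ _ (begin
          i + j₀ + g i                ≡⟨ i+j₀+gi≡d (<-trans (n<1+n i) i+1<2s) ⟩
          d                           ≡⟨ i+j₀+gi≡d i+1<2s ⟨
          suc i + j₀ + g (suc i)      ≡⟨ +-suc (i + j₀) (g (suc i)) ⟨
          i + j₀ + suc (g (suc i))    ∎))
          where open ≡-Reasoning
        g-injective : ∀ {i j} → i < s + s → j < s + s → g i ≡ g j → i ≡ j
        g-injective {i} {j} i<2s j<2s gi≡gj = +-cancelʳ-≡ j₀ i j (+-cancelʳ-≡ (g i) _ _ (begin
          i + j₀ + g i  ≡⟨ i+j₀+gi≡d i<2s ⟩
          d             ≡⟨ i+j₀+gi≡d j<2s ⟨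
          j + j₀ + g j  ≡⟨ cong (j + j₀ +_) gi≡gj ⟨
          j + j₀ + g i  ∎))
          where open ≡-Reasoning

      -- B occurs at most once on the edge, so it cannot be repeated.
      ¬middle : j₀ ≤ suc t → suc t ≤ L + j₀ → ⊥
      ¬middle j₀≤t+1 t+1≤L+j₀ =
        let i , i<s , φpᵢ≡B , φpₛ₊ᵢ≡B = both-halves {_≡ B} m<2s φpₘ≡B
        in s+i≢i (+-cancelʳ-≡ j₀ _ _ (trans (φ≡B⇒middle (on (second-half i<s)) φpₛ₊ᵢ≡B)
                                            (sym (φ≡B⇒middle (on (first-half i<s)) φpᵢ≡B))))
        where
        m = suc t ∸ j₀
        m+j₀≡t+1 : m + j₀ ≡ suc t
        m+j₀≡t+1 = m∸n+n≡m j₀≤t+1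
        m<2s : m < s + s
        m<2s = m≤pred[n]⇒suc[m]≤n
                 (+-cancelʳ-≤ j₀ m L (subst (_≤ L + j₀) (sym m+j₀≡t+1) t+1≤L+j₀))
        φpₘ≡B : φ (p m) ≡ B
        φpₘ≡B = onEdge-middle (subst (λ k → OnEdge e b k (p m)) m+j₀≡t+1 (on m<2s))

      ¬insideEdge : ⊥
      ¬insideEdge with L + j₀ ≤? t | 2 + t ≤? j₀
      ... | yes L+j₀≤t | _          = ¬firstHalf L+j₀≤t
      ... | no  _      | yes t+2≤j₀ = ¬secondHalf t+2≤j₀
      ... | no  L+j₀≰t | no  t+2≰j₀ = ¬middle (s≤s⁻¹ (≰⇒> t+2≰j₀)) (≰⇒> L+j₀≰t)

    ¬insideEdges : (∀ {i} → i < s + s → ¬ Branch (p i)) → ⊥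
    ¬insideEdges ¬branch
      with walk-avoidingBranches (forwardWalk 0 L (m≤pred[n]⇒suc[m]≤n ≤-refl))
             (¬branch ∘ m≤pred[n]⇒suc[m]≤n) (<⇒≤pred (+-mono-≤ nonempty nonempty))
    ... | e , b , j₀ , on = InsideEdge.¬insideEdge (on ∘ <⇒≤pred) ¬branch

    block-after : ∀ {a v m} → p a ≡ inj₁ v → m < t → a + t < s + s →
                  φ (p (a + suc m)) ≡ col (ψ v) m
    block-after {a} pa≡v m<t a+t<2s with edgeAfter a t pa≡v t≤D (≤-trans (s≤s z≤n) m<t) a+t<2s
    ... | e , b , refl , on = onEdge-colour (on m<t) m<t

    block-before : ∀ {a v m} → p a ≡ inj₁ v → m < t → t ≤ a → a < s + s →
                   φ (p (a ∸ suc m)) ≡ col (ψ v) m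
    block-before {a} pa≡v m<t t≤a a<2s
      with edgeBefore a t pa≡v t≤D (≤-trans (s≤s z≤n) m<t) t≤a a<2s
    ... | e , b , refl , on = onEdge-colour (on m<t) m<t

    -- The t vertices on one side of p a, and their partners s steps later, spell out c (ψ v) and c (ψ v′).
    c-agree : ∀ {a v v′} → p a ≡ inj₁ v → p (s + a) ≡ inj₁ v′ → a < s → a + t < s ⊎ t ≤ a →
              ∀ x → c (ψ v) x ≡ c (ψ v′) x
    c-agree {a} {v} {v′} pa≡v psa≡v′ a<s (inj₁ a+t<s) x = col-reflects _ _ x x (begin
      col (ψ v) m              ≡⟨ block-after pa≡v m<t (first-half a+t<s) ⟨
      φ (p (a + suc m))        ≡⟨ repeats (≤-<-trans (+-monoʳ-≤ a m<t) a+t<s) ⟩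
      φ (p (s + (a + suc m)))  ≡⟨ cong (φ ∘ p) (+-assoc s a (suc m)) ⟨
      φ (p (s + a + suc m))    ≡⟨ block-after psa≡v′ m<t s+a+t<2s ⟩
      col (ψ v′) m             ∎)
      where
      open ≡-Reasoning
      m = toℕ x
      m<t = Fin.toℕ<n x
      s+a+t<2s = subst (_< s + s) (sym (+-assoc s a t)) (second-half a+t<s)
    c-agree {a} {v} {v′} pa≡v psa≡v′ a<s (inj₂ t≤a) x = col-reflects _ _ x x (begin
      col (ψ v) m              ≡⟨ block-before pa≡v m<t t≤a (first-half a<s) ⟨
      φ (p (a ∸ suc m))        ≡⟨ repeats (≤-<-trans (m∸n≤m a (suc m)) a<s) ⟩
      φ (p (s + (a ∸ suc m)))  ≡⟨ cong (φ ∘ p) (+-∸-assoc s (≤-trans m<t t≤a)) ⟨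
      φ (p (s + a ∸ suc m))    ≡⟨ block-before psa≡v′ m<t (≤-trans t≤a (m≤n+m a s)) (second-half a<s) ⟩
      col (ψ v′) m             ∎)
      where
      open ≡-Reasoning
      m = toℕ x
      m<t = Fin.toℕ<n x

    ψ-agree : ∀ {a v v′} → p a ≡ inj₁ v → p (s + a) ≡ inj₁ v′ → a < s → a + t < s ⊎ t ≤ a →
              ψ v ≡ ψ v′
    ψ-agree {v = v} {v′} pa≡v psa≡v′ a<s side = decidable-stable (ψ v Fin.≟ ψ v′) λ ψv≢ψv′ →
      let x , cx≢c′x = c-distinct _ _ ψv≢ψv′ in cx≢c′x (c-agree pa≡v psa≡v′ a<s side x)

    module BranchVertices {q₀ h} (s≡hD : s ≡ h * D) (q₀<D : q₀ < D) (br₀ : Branch (p q₀)) where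
      pos : ℕ → ℕ
      pos j = q₀ + j * D

      pos-bound : ∀ {j m x} → q₀ + x < D → j < m → pos j + x < m * D
      pos-bound {j} {m} {x} q₀+x<D j<m = begin-strict
        q₀ + j * D + x  ≡⟨ xy∙z≈xz∙y q₀ (j * D) x ⟩
        q₀ + x + j * D  <⟨ +-monoˡ-< (j * D) q₀+x<D ⟩
        D + j * D       ≤⟨ *-monoˡ-≤ D j<m ⟩
        m * D           ∎
        where open ≤-Reasoning

      pos<mD : ∀ {j m} → j < m → pos j < m * D
      pos<mD {j} {m} j<m =
        subst (_< m * D) (+-identityʳ (pos j)) (pos-bound (subst (_< D) (sym (+-identityʳ q₀)) q₀<D) j<m)

      pos<s : ∀ {j} → j < h → pos j < s
      pos<s {j} j<h = subst (pos j <_) (sym s≡hD) (pos<mD j<h)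

      pos<2s : ∀ {j} → j < h + h → pos j < s + s
      pos<2s {j} j<2h =
        subst (pos j <_) (trans (*-distribʳ-+ D h h) (sym (cong₂ _+_ s≡hD s≡hD))) (pos<mD j<2h)

      pos-suc : ∀ j → pos (suc j) ≡ pos j + D
      pos-suc j = x∙yz≈xz∙y q₀ D (j * D)

      -- Off the branch positions w takes a junk value; only j < h + h is ever used.
      w : ℕ → Fin n
      w j = fromInj₁ (λ _ → proj₁ br₀) (p (pos j))

      w-branch : ∀ {j} → j < h + h → p (pos j) ≡ inj₁ (w j)
      w-branch {j} j<2h with branch-forward j br₀ (pos<2s j<2h)
      ... | _ , ppos≡v rewrite ppos≡v = refl

      w-adjacent : ∀ {j} → suc j < h + h → T (adj (w j) (w (suc j)))
      w-adjacent {j} j+1<2h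
        with nextBranch (pos j) (w-branch (<-trans (n<1+n j) j+1<2h))
                        (subst (_< s + s) (pos-suc j) (pos<2s j+1<2h))
      ... | w′ , ppos+D≡w′ , adj-w′ = subst (λ u → T (adj (w j) u)) w′≡w[j+1] adj-w′
        where
        w′≡w[j+1] : w′ ≡ w (suc j)
        w′≡w[j+1] = inj₁-injective (trans (sym ppos+D≡w′) (trans (cong p (sym (pos-suc j))) (w-branch j+1<2h)))

      w-injective : ∀ {i j} → i < h + h → j < h + h → w i ≡ w j → i ≡ j
      w-injective i<2h j<2h wi≡wj = *-cancelʳ-≡ _ _ D (+-cancelˡ-≡ q₀ _ _
        (injective (pos<2s i<2h) (pos<2s j<2h)
          (trans (w-branch i<2h) (trans (cong inj₁ wi≡wj) (sym (w-branch j<2h))))))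

      w-repeats : ∀ {j} → j < h → ψ (w j) ≡ ψ (w (h + j))
      w-repeats {j} j<h =
        ψ-agree (w-branch (<-≤-trans j<h (m≤m+n h h)))
                (trans (cong p (sym pos[h+j]≡s+pos[j])) (w-branch (+-monoʳ-< h j<h)))
                (pos<s j<h) side
        where
        pos[h+j]≡s+pos[j] : pos (h + j) ≡ s + pos j
        pos[h+j]≡s+pos[j] = begin
          q₀ + (h + j) * D      ≡⟨ cong (q₀ +_) (*-distribʳ-+ D h j) ⟩
          q₀ + (h * D + j * D)  ≡⟨ x∙yz≈y∙xz q₀ (h * D) (j * D) ⟩
          h * D + pos j         ≡⟨ cong (_+ pos j) s≡hD ⟨
          s + pos j             ∎
          where open ≡-Reasoning
        side : pos j + t < s ⊎ t ≤ pos j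
        side with t ≤? q₀
        ... | yes t≤q₀ = inj₂ (≤-trans t≤q₀ (m≤m+n q₀ (j * D)))
        ... | no  t≰q₀ = inj₁ (subst (_ <_) (sym s≡hD) (pos-bound q₀+t<D j<h))
          where q₀+t<D = <-trans (+-monoˡ-< t (≰⇒> t≰q₀)) (<-trans 2t<d (n<1+n d))

      h≥1 : 1 ≤ h
      h≥1 = n≢0⇒n>0 λ h≡0 → <⇒≢ nonempty (sym (trans s≡hD (cong (_* D) h≡0)))

      repetitivePathInG : RepetitivePath (toRel G) ψ h w
      repetitivePathInG = record
        { nonempty = h≥1 ; adjacent = w-adjacent ; injective = w-injective ; repeats = w-repeats }

    ¬throughBranch : ∀ {q} → q < s + s → Branch (p q) → ⊥
    ¬throughBranch q<2s br with both-halves {_≡ A} q<2s (φ-branch br)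
    ... | i , i<s , φpᵢ≡A , φpₛ₊ᵢ≡A with branch-gap s brᵢ (subst (Branch ∘ p) (+-comm s i) (φ≡A⇒branch _ φpₛ₊ᵢ≡A))
                                                         (subst (_< s + s) (+-comm s i) (second-half i<s))
      where brᵢ = φ≡A⇒branch _ φpᵢ≡A
    ... | divides h s≡hD = nonrepetitive⇒¬repetitivePath (toRel G) ψ-nonrep (BranchVertices.repetitivePathInG {h = h} s≡hD (m%n<n i D) br₀)
      where
      i≡ = m≡m%n+[m/n]*n i D
      br₀ = branch-backward (i / D) (subst (Branch ∘ p) i≡ (φ≡A⇒branch _ φpᵢ≡A)) (subst (_< s + s) i≡ (first-half i<s))

  φ-nonrepetitive : Nonrepetitive (subdivision G d) (r + 2) φ
  φ-nonrepetitive xs path rep with repetitivePath _ φ xs path rep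
  ... | s , p , rp with anyUpTo? (branch? ∘ p) (s + s)
  ... | yes (q , q<2s , br) = ¬throughBranch rp q<2s br
  ... | no  ¬∃branch        = ¬insideEdges rp (λ i<2s br → ¬∃branch (_ , i<2s , br))

lemma90 : (k r t : ℕ) → AtLeastKNonrepColourings k r t →
    (G : Graph) → πLeq (toRel G) k →
    πLeq (subdivision G (2 * t + 1)) (r + 2)
lemma90 k r t (c , c-nonrep , c-distinct) G (ψ , ψ-nonrep) =
  Colouring.φ c G ψ , Repetitions.φ-nonrepetitive c-nonrep c-distinct G ψ-nonrep
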